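{- Let $\mathbf{D}=(d_{i,j})\in\mathbb{N}^{k\times n}$ be a tree degree matrix without common leaves, and assume $n\ge 22k-11$. Then there are at most $11$ columns $j$ whose column sum $\sum_{i=1}^k d_{i,j}$ is at least $\frac{n}{6}$.
   Context: A tree degree sequence $d_1,\dots,d_n$ is a sequence of positive integers with $\sum_j d_j=2n-2$. A $k\times n$ matrix is a tree degree matrix if each row is a tree degree sequence; it has no common leaves if each column contains at most one entry equal to $1$. The degree of a vertex (column) is its column sum. -}

module Defs where

open import Data.Nat using (ℕ; zero; suc; _+_; _*_; _∸_; _≤_)
open import Data.Fin using (Fin; zero; suc)
open import Data.Product using (_×_)
open import Data.Bool using (Bool)
open import Relation.Nullary.Decidable using (⌊_⌋)
open import Data.Nat using (_≟_; _≤?_)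

sumFin : (n : ℕ) → (Fin n → ℕ) → ℕ
sumFin zero    f = 0
sumFin (suc n) f = f zero + sumFin n (λ j → f (suc j))

countFin : (n : ℕ) → (Fin n → Bool) → ℕ
countFin zero    p = 0
countFin (suc n) p with p zero
... | Bool.true  = suc (countFin n (λ j → p (suc j)))
... | Bool.false = countFin n (λ j → p (suc j))

Matrix : ℕ → ℕ → Set
Matrix k n = Fin k → Fin n → ℕ

IsTreeDegreeSeq : (n : ℕ) → (Fin n → ℕ) → Set
IsTreeDegreeSeq n d = (∀ j → 1 ≤ d j) × (sumFin n d ≡ 2 * n ∸ 2)
  where open import Relation.Binary.PropositionalEquality using (_≡_)

IsTreeDegreeMatrix : (k n : ℕ) → Matrix k n → Set
IsTreeDegreeMatrix k n D = ∀ i → IsTreeDegreeSeq n (D i)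

NoCommonLeaves : (k n : ℕ) → Matrix k n → Set
NoCommonLeaves k n D = ∀ j → countFin k (λ i → ⌊ D i j ≟ 1 ⌋) ≤ 1

colSum : (k n : ℕ) → Matrix k n → Fin n → ℕ
colSum k n D j = sumFin k (λ i → D i j)

-- Every column has sum at least 2k − 1, since at most one of its k positive
-- entries equals 1, and all column sums together equal k(2n − 2). Give each
-- heavy column (6·sum ≥ n) weight n + 6 and every other column weight 12k;
-- both are at most 6·(column sum + 1), so summing over the columns gives
-- m(n + 6) + (n − m)·12k ≤ 6k(2n − 2) + 6n for m heavy columns. When
-- n ≥ 22k − 11 this linear inequality in m fails for every m ≥ 12.
module Submission where

open import Defs
open import Data.Nat using (ℕ; zero; suc; _+_; _*_; _∸_; _≤_; _≤?_; _≟_; z≤n; s≤s)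
open import Data.Nat.Properties
open import Data.Nat.Tactic.RingSolver using (solve)
open import Algebra.Properties.CommutativeSemigroup +-commutativeSemigroup using (interchange; x∙yz≈y∙xz)
open import Data.Fin using (Fin; zero; suc)
open import Data.Bool using (Bool; true; false; if_then_else_)
open import Data.List using (_∷_; [])
open import Data.Product using (_,_; proj₁; proj₂)
open import Data.Empty using (⊥-elim)
open import Function using (_∘_)
open import Relation.Nullary using (yes; no)
open import Relation.Nullary.Decidable using (⌊_⌋)
open import Relation.Binary.PropositionalEquality

sumFin-cong : ∀ n {f g : Fin n → ℕ} → (∀ j → f j ≡ g j) → sumFin n f ≡ sumFin n g
sumFin-cong zero    f≗g = refl
sumFin-cong (suc n) f≗g = cong₂ _+_ (f≗g zero) (sumFin-cong n (λ j → f≗g (suc j)))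

sumFin-mono-≤ : ∀ n {f g : Fin n → ℕ} → (∀ j → f j ≤ g j) → sumFin n f ≤ sumFin n g
sumFin-mono-≤ zero    f≤g = z≤n
sumFin-mono-≤ (suc n) f≤g = +-mono-≤ (f≤g zero) (sumFin-mono-≤ n (λ j → f≤g (suc j)))

sumFin-const : ∀ n c → sumFin n (λ _ → c) ≡ n * c
sumFin-const zero    c = refl
sumFin-const (suc n) c = cong (c +_) (sumFin-const n c)

sumFin-distrib-+ : ∀ n (f g : Fin n → ℕ) →
  sumFin n (λ j → f j + g j) ≡ sumFin n f + sumFin n g
sumFin-distrib-+ zero    f g = refl
sumFin-distrib-+ (suc n) f g =
  trans (cong (f zero + g zero +_) (sumFin-distrib-+ n (λ j → f (suc j)) (λ j → g (suc j))))
        (interchange (f zero) (g zero) _ _)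

*-distribˡ-sumFin : ∀ n a (f : Fin n → ℕ) → a * sumFin n f ≡ sumFin n (λ j → a * f j)
*-distribˡ-sumFin zero    a f = *-zeroʳ a
*-distribˡ-sumFin (suc n) a f =
  trans (*-distribˡ-+ a (f zero) _) (cong (a * f zero +_) (*-distribˡ-sumFin n a (λ j → f (suc j))))

sumFin-comm : ∀ k n (D : Fin k → Fin n → ℕ) →
  sumFin n (λ j → sumFin k (λ i → D i j)) ≡ sumFin k (λ i → sumFin n (D i))
sumFin-comm zero    n D = trans (sumFin-const n 0) (*-zeroʳ n)
sumFin-comm (suc k) n D =
  trans (sumFin-distrib-+ n (D zero) (λ j → sumFin k (λ i → D (suc i) j)))
        (cong (sumFin n (D zero) +_) (sumFin-comm k n (λ i → D (suc i))))

sumFin-if+countFin : ∀ n (p : Fin n → Bool) x y →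
  sumFin n (λ j → if p j then x else y) + countFin n p * y ≡ countFin n p * x + n * y
sumFin-if+countFin zero    p x y = refl
sumFin-if+countFin (suc n) p x y with p zero | sumFin-if+countFin n (λ j → p (suc j)) x y
... | true  | ih = begin
  x + S + (y + C * y)     ≡⟨ interchange x S y (C * y) ⟩
  x + y + (S + C * y)     ≡⟨ cong (x + y +_) ih ⟩
  x + y + (C * x + n * y) ≡⟨ interchange x y (C * x) (n * y) ⟩
  x + C * x + (y + n * y) ∎
  where
  open ≡-Reasoning
  S C : ℕ
  S = sumFin n (λ j → if p (suc j) then x else y)
  C = countFin n (λ j → p (suc j))
... | false | ih = begin
  y + S + C * y       ≡⟨ +-assoc y S (C * y) ⟩
  y + (S + C * y)     ≡⟨ cong (y +_) ih ⟩
  y + (C * x + n * y) ≡⟨ x∙yz≈y∙xz y (C * x) (n * y) ⟩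
  C * x + (y + n * y) ∎
  where
  open ≡-Reasoning
  S C : ℕ
  S = sumFin n (λ j → if p (suc j) then x else y)
  C = countFin n (λ j → p (suc j))

double-≤-sumFin+countOnes : ∀ k (f : Fin k → ℕ) → (∀ i → 1 ≤ f i) →
  k + k ≤ sumFin k f + countFin k (λ i → ⌊ f i ≟ 1 ⌋)
double-≤-sumFin+countOnes zero    f f≥1 = z≤n
double-≤-sumFin+countOnes (suc k) f f≥1
  with f zero ≟ 1 | double-≤-sumFin+countOnes k (λ i → f (suc i)) (λ i → f≥1 (suc i))
... | yes _   | ih = begin
  suc k + suc k          ≡⟨ cong suc (+-suc k k) ⟩
  2 + (k + k)            ≤⟨ +-mono-≤ (s≤s (f≥1 zero)) ih ⟩
  suc (f zero + (S + C)) ≡⟨ +-suc (f zero) (S + C) ⟨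
  f zero + suc (S + C)   ≡⟨ cong (f zero +_) (+-suc S C) ⟨
  f zero + (S + suc C)   ≡⟨ +-assoc (f zero) S (suc C) ⟨
  f zero + S + suc C     ∎
  where
  open ≤-Reasoning
  S C : ℕ
  S = sumFin k (λ i → f (suc i))
  C = countFin k (λ i → ⌊ f (suc i) ≟ 1 ⌋)
... | no f₀≢1 | ih = begin
  suc k + suc k       ≡⟨ cong suc (+-suc k k) ⟩
  2 + (k + k)         ≤⟨ +-mono-≤ (≤∧≢⇒< (f≥1 zero) (f₀≢1 ∘ sym)) ih ⟩
  f zero + (S + C)    ≡⟨ +-assoc (f zero) S C ⟨
  f zero + S + C      ∎
  where
  open ≤-Reasoning
  S C : ℕ
  S = sumFin k (λ i → f (suc i))
  C = countFin k (λ i → ⌊ f (suc i) ≟ 1 ⌋)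

heavyCount≤11 : ∀ k n m →
  m * (suc n + 6) + suc n * (12 * k) ≤ 6 * (k * (2 * suc n ∸ 2)) + suc n * 6 + m * (12 * k) →
  22 * k ≤ suc n + 11 → m ≤ 11
-- Multiplying the budget by 11 lets 22k ≤ n + 11 absorb every occurrence of k.
heavyCount≤11 k n m budget 22k≤n+11 with m ≤? 11
... | yes m≤11 = m≤11
... | no m≰11 with m≤n⇒∃[o]m+o≡n (≰⇒> m≰11)
...   | t , refl = ⊥-elim (<-irrefl refl (begin-strict
  132 * k * suc n + 66 * suc n + 6 * (11 + t) * (suc n + 11)
                                                   <⟨ m<m+n _ (s≤s z≤n) ⟩
  132 * k * suc n + 66 * suc n + 6 * (11 + t) * (suc n + 11) + (66 + 5 * t * suc n)
                                                   ≡⟨ solve (k ∷ n ∷ t ∷ []) ⟩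
  11 * ((12 + t) * (suc n + 6) + suc n * (12 * k)) ≤⟨ *-monoʳ-≤ 11 budget′ ⟩
  11 * (6 * (k * (2 * n)) + suc n * 6 + (12 + t) * (12 * k))
                                                   ≡⟨ solve (k ∷ n ∷ t ∷ []) ⟩
  132 * k * suc n + 66 * suc n + 6 * (11 + t) * (22 * k)
                                                   ≤⟨ +-monoʳ-≤ _ (*-monoʳ-≤ (6 * (11 + t)) 22k≤n+11) ⟩
  132 * k * suc n + 66 * suc n + 6 * (11 + t) * (suc n + 11)
                                                   ∎))
  where
  open ≤-Reasoning
  budget′ : (12 + t) * (suc n + 6) + suc n * (12 * k)
          ≤ 6 * (k * (2 * n)) + suc n * 6 + (12 + t) * (12 * k)
  budget′ = subst (λ e → (12 + t) * (suc n + 6) + suc n * (12 * k)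
                       ≤ 6 * (k * e) + suc n * 6 + (12 + t) * (12 * k))
                  (cong (_∸ 2) (*-suc 2 n)) budget

module _ {k n : ℕ} {D : Matrix k n} (tree : IsTreeDegreeMatrix k n D) where

  sumFin-colSum : sumFin n (colSum k n D) ≡ k * (2 * n ∸ 2)
  sumFin-colSum = begin
    sumFin n (colSum k n D)                 ≡⟨ sumFin-comm k n D ⟩
    sumFin k (λ i → sumFin n (D i))         ≡⟨ sumFin-cong k (λ i → proj₂ (tree i)) ⟩
    sumFin k (λ _ → 2 * n ∸ 2)              ≡⟨ sumFin-const k (2 * n ∸ 2) ⟩
    k * (2 * n ∸ 2)                         ∎
    where open ≡-Reasoning

  12k≤6*colSum+6 : NoCommonLeaves k n D → ∀ j → 12 * k ≤ 6 * colSum k n D j + 6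
  12k≤6*colSum+6 noCommon j = begin
    12 * k                          ≡⟨ *-assoc 6 2 k ⟩
    6 * (2 * k)                     ≡⟨ cong (6 *_) (cong (k +_) (+-identityʳ k)) ⟩
    6 * (k + k)                     ≤⟨ *-monoʳ-≤ 6 2k≤c+1 ⟩
    6 * (colSum k n D j + 1)        ≡⟨ *-distribˡ-+ 6 (colSum k n D j) 1 ⟩
    6 * colSum k n D j + 6          ∎
    where
    open ≤-Reasoning
    2k≤c+1 : k + k ≤ colSum k n D j + 1
    2k≤c+1 = ≤-trans (double-≤-sumFin+countOnes k (λ i → D i j) (λ i → proj₁ (tree i) j))
                     (+-monoʳ-≤ (colSum k n D j) (noCommon j))

  sumFin-6*colSum+6 : sumFin n (λ j → 6 * colSum k n D j + 6) ≡ 6 * (k * (2 * n ∸ 2)) + n * 6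
  sumFin-6*colSum+6 = begin
    sumFin n (λ j → 6 * c j + 6)
      ≡⟨ sumFin-distrib-+ n (λ j → 6 * c j) (λ _ → 6) ⟩
    sumFin n (λ j → 6 * c j) + sumFin n (λ _ → 6)
      ≡⟨ cong₂ _+_ (sym (*-distribˡ-sumFin n 6 c)) (sumFin-const n 6) ⟩
    6 * sumFin n c + n * 6
      ≡⟨ cong (λ s → 6 * s + n * 6) sumFin-colSum ⟩
    6 * (k * (2 * n ∸ 2)) + n * 6
      ∎
    where
    open ≡-Reasoning
    c : Fin n → ℕ
    c = colSum k n D

  heavyColumnBudget : NoCommonLeaves k n D →
    let m = countFin n (λ j → ⌊ n ≤? 6 * colSum k n D j ⌋) in
    m * (n + 6) + n * (12 * k) ≤ 6 * (k * (2 * n ∸ 2)) + n * 6 + m * (12 * k)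
  heavyColumnBudget noCommon = begin
    m * (n + 6) + n * (12 * k)                  ≡⟨ sumFin-if+countFin n heavy (n + 6) (12 * k) ⟨
    sumFin n weight + m * (12 * k)              ≤⟨ +-monoˡ-≤ _ (sumFin-mono-≤ n weight≤) ⟩
    sumFin n (λ j → 6 * c j + 6) + m * (12 * k) ≡⟨ cong (_+ m * (12 * k)) sumFin-6*colSum+6 ⟩
    6 * (k * (2 * n ∸ 2)) + n * 6 + m * (12 * k) ∎
    where
    open ≤-Reasoning
    c : Fin n → ℕ
    c = colSum k n D
    heavy : Fin n → Bool
    heavy j = ⌊ n ≤? 6 * c j ⌋
    m : ℕ
    m = countFin n heavy
    weight : Fin n → ℕ
    weight j = if heavy j then n + 6 else 12 * k
    weight≤ : ∀ j → weight j ≤ 6 * c j + 6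
    weight≤ j with n ≤? 6 * c j
    ... | yes n≤6cⱼ = +-monoˡ-≤ 6 n≤6cⱼ
    ... | no _      = 12k≤6*colSum+6 noCommon j

mainTheorem13 : (k n : ℕ) (D : Matrix k n) →
    IsTreeDegreeMatrix k n D → NoCommonLeaves k n D → 22 * k ≤ n + 11 →
    countFin n (λ j → ⌊ n ≤? 6 * colSum k n D j ⌋) ≤ 11
mainTheorem13 k zero    D tree noCommon 22k≤n+11 = z≤n
mainTheorem13 k (suc n) D tree noCommon 22k≤n+11 =
  heavyCount≤11 k n _ (heavyColumnBudget tree noCommon) 22k≤n+11
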